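{- Let $\lambda$ be a partition with $\lambda_i\ge i$ for all $i$, let $i$ be a row with $g_i\neq 0$, and suppose the move producing the coatom $c_i$ from $\hat{1}$ sends the rook at $(i,j)$ to $(i,k)$. Then for any maximal rook placement $x$, we have $x\le c_i$ in $P_\lambda$ if and only if the increasingly sorted list of $\{x_1,\dots,x_i\}$ is entrywise $\le$ the increasingly sorted list of $\{\hat{1}_1,\dots,\hat{1}_{i-1},k\}$.
   Context: Ferrers board of $\lambda=(\lambda_1\le\cdots\le\lambda_n)$: cells $(i,j)$, row $i$ from the bottom, $1\le j\le\lambda_i$; $g_i=\lambda_i-i$. Maximal rook placements: sequences $x=(x_1,\dots,x_n)$ of distinct integers with $1\le x_i\le\lambda_i$; rook poset $P_\lambda$: $x\le y$ iff for all $m$ the sorted list of $\{x_1,\dots,x_m\}$ is entrywise $\le$ that of $\{y_1,\dots,y_m\}$. Maximum $\hat{1}$: $\hat{1}_i=\max(\{1,\dots,\lambda_i\}\setminus\{\hat{1}_1,\dots,\hat{1}_{i-1}\})$. Switch move on rook $i$: if rooks occupy $(i,j)$ and $(k,l)$ with $i<k$, $j>l$, and the rectangle with these corners contains no other rooks, replace them by $(i,l)$ and $(k,j)$. Push move on rook $i$: if a rook occupies $(i,j)$, column $k<j$ is empty, and every column $r$ with $k<r<j$ has a rook below row $i$, replace $(i,j)$ by $(i,k)$. For each $i$ with $g_i\ne0$ exactly one placement is obtained from $\hat{1}$ by a single switch or push move on rook $i$; this is the coatom $c_i$ (coatoms are the elements covered by $\hat{1}$). -}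

module Defs where

open import Data.Nat using (ℕ; zero; suc; _≤_; _<_; _≟_)
open import Data.Nat.Properties using (≤-decTotalOrder)
open import Data.Fin using (Fin; toℕ)
open import Data.List using (List; []; _∷_; _++_; take; tabulate)
open import Data.List.Membership.DecPropositional _≟_ using (_∈?_)
open import Data.List.Relation.Binary.Pointwise using (Pointwise)
open import Data.Vec using (Vec; lookup)
import Data.Vec as Vec
open import Data.Product using (Σ; _×_; ∃)
open import Relation.Binary.PropositionalEquality using (_≡_; _≢_)
open import Relation.Nullary using (¬_; yes; no)
open import Data.List.Sort ≤-decTotalOrder using (sort)

-- Rows are indexed by Fin n: the index i : Fin n stands for row (toℕ i + 1).
-- A shape λ is a function Fin n → ℕ (λ i = length of row toℕ i + 1).

IsPartition : ∀ {n} → (Fin n → ℕ) → Set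
IsPartition {n} lam = ∀ (i j : Fin n) → toℕ i ≤ toℕ j → lam i ≤ lam j

-- Maximal rook placement: distinct columns, 1 ≤ x_i ≤ λ_i
IsPlacement : ∀ {n} → (Fin n → ℕ) → (Fin n → ℕ) → Set
IsPlacement {n} lam x =
  (∀ (i j : Fin n) → x i ≡ x j → i ≡ j) × (∀ (i : Fin n) → 1 ≤ x i × x i ≤ lam i)

prefix : ∀ {n} → (Fin n → ℕ) → ℕ → List ℕ
prefix x m = take m (tabulate x)

SortedLeq : List ℕ → List ℕ → Set
SortedLeq xs ys = Pointwise _≤_ (sort xs) (sort ys)

_≤P_ : ∀ {n} → (Fin n → ℕ) → (Fin n → ℕ) → Set
_≤P_ {n} x y = ∀ (m : ℕ) → 1 ≤ m → m ≤ n → SortedLeq (prefix x m) (prefix y m)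

-- largest c with 1 ≤ c ≤ b and c ∉ used (0 if there is none)
maxAvail : ℕ → List ℕ → ℕ
maxAvail zero used = zero
maxAvail (suc b) used with suc b ∈? used
... | yes _ = maxAvail b used
... | no _ = suc b

hatGo : ∀ {m} → List ℕ → Vec ℕ m → Vec ℕ m
hatGo used Vec.[] = Vec.[]
hatGo used (l Vec.∷ ls) = maxAvail l used Vec.∷ hatGo (used ++ (maxAvail l used ∷ [])) ls

-- 1̂_i = max({1..λ_i} \ {1̂_1, ..., 1̂_{i-1}})
oneHat : ∀ {n} → (Fin n → ℕ) → Fin n → ℕ
oneHat lam i = lookup (hatGo [] (Vec.tabulate lam)) i

SwitchMove : ∀ {n} → (Fin n → ℕ) → (Fin n → ℕ) → Fin n → Set
SwitchMove {n} y c i = Σ (Fin n) λ k →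
  (toℕ i < toℕ k) × (y k < y i)
  × (∀ (r : Fin n) → r ≢ i → r ≢ k →
       ¬ (toℕ i ≤ toℕ r × toℕ r ≤ toℕ k × y k ≤ y r × y r ≤ y i))
  × (c i ≡ y k) × (c k ≡ y i)
  × (∀ (r : Fin n) → r ≢ i → r ≢ k → c r ≡ y r)

-- Push move on rook i taking y to c: rook at (i,j), column k < j empty
-- (k a column, so 1 ≤ k), every column r with k < r < j has a rook in a row
-- below row i; the rook is moved to (i,k).
PushMove : ∀ {n} → (Fin n → ℕ) → (Fin n → ℕ) → Fin n → Set
PushMove {n} y c i = Σ ℕ λ k →
  (1 ≤ k) × (k < y i)
  × (∀ (r : Fin n) → y r ≢ k)
  × (∀ (col : ℕ) → k < col → col < y i → ∃ λ (s : Fin n) → toℕ s < toℕ i × y s ≡ col)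
  × (c i ≡ k)
  × (∀ (r : Fin n) → r ≢ i → c r ≡ y r)

{-# OPTIONS --safe #-}
module Submission where

open import Defs
open import Data.Nat using (ℕ; zero; suc; _+_; _⊓_; _≤_; _<_; _≤?_; _<?_; _≟_; z≤n; s≤s; z<s; s<s)
open import Data.Nat.Properties
open import Algebra.Properties.CommutativeSemigroup +-commutativeSemigroup using (xy∙z≈xz∙y)
open import Data.Fin using (Fin; toℕ; fromℕ<) renaming (zero to fzero; suc to fsuc)
import Data.Fin as Fin
open import Data.Fin.Properties using (toℕ-fromℕ<; toℕ<n; toℕ-injective) renaming (<⇒≢ to <⇒≢ᶠ)
open import Data.List using (List; []; _∷_; _++_; [_]; length; filter; tabulate)
open import Data.List.Membership.Propositional using (_∈_; _∉_)
open import Data.List.Properties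
  using (filter-++; length-++; length-filter; filter-all; filter-none; filter-accept;
         filter-reject; take-suc-tabulate; length-take; length-tabulate; ++-identityʳ; ++-assoc)
open import Data.List.Relation.Binary.Permutation.Propositional using (_↭_)
open import Data.List.Relation.Binary.Permutation.Propositional.Properties
  using (filter-↭; ↭-length)
open import Data.List.Relation.Binary.Pointwise using (Pointwise; []; _∷_)
open import Data.List.Relation.Unary.All as All using (All; []; _∷_)
open import Data.List.Relation.Unary.Any using (here; there)
import Data.List.Relation.Unary.Linked as Linked
open import Data.List.Relation.Unary.Linked.Properties using (Linked⇒All)
open import Data.List.Relation.Unary.Unique.Propositional using (Unique; []; _∷_)
import Data.List.Relation.Unary.Unique.Propositional.Properties as Unique
open import Data.List.Sort ≤-decTotalOrder using (sort; sort-↭; sort-↗)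
open import Data.List.Relation.Unary.Sorted.TotalOrder ≤-totalOrder using (Sorted)
open import Data.List.Membership.DecPropositional _≟_ using (_∈?_)
open import Data.Vec using (lookup)
import Data.Vec as Vec
open import Data.Product using (∃; _×_; _,_; proj₂)
open import Data.Sum using (_⊎_; inj₁; inj₂; [_,_]′; map₁)
open import Function.Base using (_∘_)
open import Function.Bundles using (_⇔_; mk⇔; Equivalence)
open import Relation.Binary.PropositionalEquality
  using (_≡_; _≢_; refl; sym; trans; cong; cong₂; subst; subst₂)
open import Relation.Binary.Definitions using (tri<; tri≈; tri>)
open import Relation.Nullary using (¬_; yes; no; contradiction)

open ≤-Reasoning

-- Entrywise comparison of sorted lists of equal length is the same as comparing, for every
-- threshold t, the numbers of entries ≥ t; so x ≤ y in the rook poset says that every prefix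
-- of x has at most as many rooks in columns ≥ t as the same prefix of y. The greedy 1̂
-- maximises all these counts: when t > 1̂_r, every column in [t, λ_r] is already taken by an
-- earlier rook of 1̂, while the first r rooks of x occupy distinct columns ≤ λ_r, at most
-- λ_r + 1 - t of them in [t, λ_r].
-- The coatom c is 1̂ with the rook of row i moved left from column 1̂_i to k, and, for a
-- switch, the rook of a later row K moved from k to 1̂_i. Its prefix counts therefore equal
-- those of 1̂, hence dominate those of x, except at thresholds k < t ≤ 1̂_i for prefixes
-- ending in rows i, ..., K - 1. There every row strictly between i and K has its rook right
-- of 1̂_i, so the count of c grows by one per row, at least as fast as that of x, and the
-- single comparison at row i propagates.

-- Counting entries above a threshold

count≥ : ℕ → List ℕ → ℕ
count≥ t xs = length (filter (t ≤?_) xs)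

count≥-++ : ∀ t xs ys → count≥ t (xs ++ ys) ≡ count≥ t xs + count≥ t ys
count≥-++ t xs ys = trans (cong length (filter-++ (t ≤?_) xs ys)) (length-++ (filter (t ≤?_) xs))

count≥-↭ : ∀ t {xs ys} → xs ↭ ys → count≥ t xs ≡ count≥ t ys
count≥-↭ t xs↭ys = ↭-length (filter-↭ (t ≤?_) xs↭ys)

count≥≤length : ∀ t xs → count≥ t xs ≤ length xs
count≥≤length t = length-filter (t ≤?_)

count≥-all : ∀ {t xs} → All (t ≤_) xs → count≥ t xs ≡ length xs
count≥-all {t} t≤xs = cong length (filter-all (t ≤?_) t≤xs)

count≥-none : ∀ {t xs} → All (_< t) xs → count≥ t xs ≡ 0
count≥-none {t} xs<t = cong length (filter-none (t ≤?_) (All.map <⇒≱ xs<t))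

count≥-reject : ∀ {t v} xs → ¬ t ≤ v → count≥ t (v ∷ xs) ≡ count≥ t xs
count≥-reject {t} _ t≰v = cong length (filter-reject (t ≤?_) t≰v)

count≥-[-]-cong : ∀ {t a b} → a ≤ b → t ≤ a ⊎ b < t → count≥ t [ a ] ≡ count≥ t [ b ]
count≥-[-]-cong a≤b (inj₁ t≤a) =
  trans (count≥-all (t≤a ∷ [])) (sym (count≥-all (≤-trans t≤a a≤b ∷ [])))
count≥-[-]-cong a≤b (inj₂ b<t) =
  trans (count≥-none (≤-<-trans a≤b b<t ∷ [])) (sym (count≥-none (b<t ∷ [])))

count≥-accept : ∀ {t v} xs → t ≤ v → count≥ t (v ∷ xs) ≡ suc (count≥ t xs)
count≥-accept {t} _ t≤v = cong length (filter-accept (t ≤?_) t≤v)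

count≥-antimono : ∀ {s t} xs → s ≤ t → count≥ t xs ≤ count≥ s xs
count≥-antimono [] s≤t = z≤n
count≥-antimono {s} {t} (x ∷ xs) s≤t with t ≤? x | s ≤? x
... | yes t≤x | _       rewrite count≥-accept xs t≤x | count≥-accept xs (≤-trans s≤t t≤x) =
  s≤s (count≥-antimono xs s≤t)
... | no t≰x  | yes s≤x rewrite count≥-reject xs t≰x | count≥-accept xs s≤x =
  m≤n⇒m≤1+n (count≥-antimono xs s≤t)
... | no t≰x  | no s≰x  rewrite count≥-reject xs t≰x | count≥-reject xs s≰x =
  count≥-antimono xs s≤t

count≥-mono-pointwise : ∀ t {as bs} → Pointwise _≤_ as bs → count≥ t as ≤ count≥ t bs
count≥-mono-pointwise t [] = z≤n
count≥-mono-pointwise t {a ∷ as} {b ∷ bs} (a≤b ∷ as≤bs) with t ≤? a | t ≤? b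
... | yes t≤a | _       rewrite count≥-accept as t≤a | count≥-accept bs (≤-trans t≤a a≤b) =
  s≤s (count≥-mono-pointwise t as≤bs)
... | no t≰a  | yes t≤b rewrite count≥-reject as t≰a | count≥-accept bs t≤b =
  m≤n⇒m≤1+n (count≥-mono-pointwise t as≤bs)
... | no t≰a  | no t≰b  rewrite count≥-reject as t≰a | count≥-reject bs t≰b =
  count≥-mono-pointwise t as≤bs

count≥⇒pointwise : ∀ {as bs} → Sorted as → Sorted bs → length as ≡ length bs →
                   (∀ t → count≥ t as ≤ count≥ t bs) → Pointwise _≤_ as bs
count≥⇒pointwise {[]}     {[]}     _   _   _  _   = []
count≥⇒pointwise {a ∷ as} {b ∷ bs} as↗ bs↗ eq dom =
  a≤b ∷ count≥⇒pointwise (Linked.tail as↗) (Linked.tail bs↗) (suc-injective eq) tail-dom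
  where
  a≤b : a ≤ b
  a≤b with a ≤? b
  ... | yes a≤b = a≤b
  ... | no a≰b = contradiction (begin
    suc (length as)   ≡⟨ count≥-all (Linked⇒All ≤-trans ≤-refl as↗) ⟨
    count≥ a (a ∷ as) ≤⟨ dom a ⟩
    count≥ a (b ∷ bs) ≡⟨ count≥-reject bs a≰b ⟩
    count≥ a bs       ≤⟨ count≥≤length a bs ⟩
    length bs         ≡⟨ suc-injective eq ⟨
    length as         ∎) (n≮n (length as))
  tail-dom : ∀ t → count≥ t as ≤ count≥ t bs
  tail-dom t with t ≤? b
  ... | yes t≤b = begin
    count≥ t as ≤⟨ count≥≤length t as ⟩
    length as   ≡⟨ suc-injective eq ⟩
    length bs   ≡⟨ count≥-all (All.tail (Linked⇒All ≤-trans t≤b bs↗)) ⟨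
    count≥ t bs ∎
  ... | no t≰b = begin
    count≥ t as       ≡⟨ count≥-reject as (λ t≤a → t≰b (≤-trans t≤a a≤b)) ⟨
    count≥ t (a ∷ as) ≤⟨ dom t ⟩
    count≥ t (b ∷ bs) ≡⟨ count≥-reject bs t≰b ⟩
    count≥ t bs       ∎

SortedLeq⇔count≥ : ∀ {A B} → length A ≡ length B →
                   SortedLeq A B ⇔ (∀ t → count≥ t A ≤ count≥ t B)
SortedLeq⇔count≥ {A} {B} eq = mk⇔
  (λ sA≤sB t → subst₂ _≤_ (count≥-↭ t (sort-↭ A)) (count≥-↭ t (sort-↭ B))
                          (count≥-mono-pointwise t sA≤sB))
  (λ dom → count≥⇒pointwise (sort-↗ A) (sort-↗ B) sorted-lengths λ t →
             subst₂ _≤_ (sym (count≥-↭ t (sort-↭ A))) (sym (count≥-↭ t (sort-↭ B))) (dom t))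
  where
  sorted-lengths : length (sort A) ≡ length (sort B)
  sorted-lengths = trans (↭-length (sort-↭ A)) (trans eq (sym (↭-length (sort-↭ B))))

count≥-suc-∈ : ∀ {t} xs → t ∈ xs → count≥ (suc t) xs < count≥ t xs
count≥-suc-∈ {t} (t ∷ xs) (here refl)
  rewrite count≥-reject xs (n≮n t) | count≥-accept xs (≤-refl {t}) =
  s≤s (count≥-antimono xs (n≤1+n t))
count≥-suc-∈ {t} (x ∷ xs) (there t∈xs) with t ≤? x | suc t ≤? x
... | _       | yes t<x rewrite count≥-accept xs t<x | count≥-accept xs (<⇒≤ t<x) =
  s≤s (count≥-suc-∈ xs t∈xs)
... | yes t≤x | no t≮x  rewrite count≥-reject xs t≮x | count≥-accept xs t≤x =
  m<n⇒m<1+n (count≥-suc-∈ xs t∈xs)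
... | no t≰x  | no t≮x  rewrite count≥-reject xs t≮x | count≥-reject xs t≰x =
  count≥-suc-∈ xs t∈xs

count≥-∉ : ∀ {t} xs → t ∉ xs → count≥ t xs ≤ count≥ (suc t) xs
count≥-∉ [] _ = z≤n
count≥-∉ {t} (x ∷ xs) t∉ with t ≤? x | suc t ≤? x
... | _       | yes t<x rewrite count≥-accept xs t<x | count≥-accept xs (<⇒≤ t<x) =
  s≤s (count≥-∉ xs (λ t∈xs → t∉ (there t∈xs)))
... | yes t≤x | no t≮x  = contradiction (here (≤-antisym t≤x (≮⇒≥ t≮x))) t∉
... | no t≰x  | no t≮x  rewrite count≥-reject xs t≮x | count≥-reject xs t≰x =
  count≥-∉ xs (λ t∈xs → t∉ (there t∈xs))

count≥-suc-unique : ∀ {t xs} → Unique xs → count≥ t xs ≤ suc (count≥ (suc t) xs)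
count≥-suc-unique [] = z≤n
count≥-suc-unique {t} {x ∷ xs} (x∉xs ∷ xs!) with t ≤? x | suc t ≤? x
... | _       | yes t<x rewrite count≥-accept xs t<x | count≥-accept xs (<⇒≤ t<x) =
  s≤s (count≥-suc-unique {t} xs!)
... | yes t≤x | no t≮x  rewrite count≥-reject xs t≮x | count≥-accept xs t≤x =
  s≤s (count≥-∉ xs λ t∈xs → All.lookup x∉xs t∈xs (≤-antisym (≮⇒≥ t≮x) t≤x))
... | no t≰x  | no t≮x  rewrite count≥-reject xs t≮x | count≥-reject xs t≰x =
  count≥-suc-unique {t} xs!

count≥-unique-≤-cover : ∀ {xs ys L t} → Unique xs → All (_≤ L) xs →
                        (∀ {v} → t ≤ v → v ≤ L → v ∈ ys) → count≥ t xs ≤ count≥ t ys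
count≥-unique-≤-cover {xs} {ys} {L} {t} xs! xs≤L =
  go (suc L) (≤-trans (n<1+n L) (m≤m+n (suc L) t))
  where
  go : ∀ k {t} → L < k + t → (∀ {v} → t ≤ v → v ≤ L → v ∈ ys) → count≥ t xs ≤ count≥ t ys
  go k {t} L<k+t covered with L <? t | k
  ... | yes L<t | _ =
    subst (_≤ count≥ t ys) (sym (count≥-none (All.map (λ v≤L → ≤-<-trans v≤L L<t) xs≤L))) z≤n
  ... | no L≮t | zero = contradiction L<k+t L≮t
  ... | no L≮t | suc k = begin
    count≥ t xs             ≤⟨ count≥-suc-unique {t} xs! ⟩
    suc (count≥ (suc t) xs) ≤⟨ s≤s (go k (subst (L <_) (sym (+-suc k t)) L<k+t)
                                           (λ t<v → covered (<⇒≤ t<v))) ⟩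
    suc (count≥ (suc t) ys) ≤⟨ count≥-suc-∈ ys (covered ≤-refl (≮⇒≥ L≮t)) ⟩
    count≥ t ys             ∎

-- Prefixes of a row function

prefix-suc : ∀ {n} (f : Fin n → ℕ) r → prefix f (suc (toℕ r)) ≡ prefix f (toℕ r) ++ [ f r ]
prefix-suc = take-suc-tabulate

length-prefix : ∀ {n} (f : Fin n → ℕ) m → length (prefix f m) ≡ m ⊓ n
length-prefix f m = trans (length-take m (tabulate f)) (cong (m ⊓_) (length-tabulate f))

prefix-unique : ∀ {n} {f : Fin n → ℕ} → (∀ i j → f i ≡ f j → i ≡ j) → ∀ m → Unique (prefix f m)
prefix-unique f-inj m = Unique.take⁺ m (Unique.tabulate⁺ (f-inj _ _))

prefix-cong : ∀ {n} {f g : Fin n → ℕ} m → (∀ r → toℕ r < m → f r ≡ g r) → prefix f m ≡ prefix g m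
prefix-cong {zero}  _       _   = refl
prefix-cong {suc n} zero    _   = refl
prefix-cong {suc n} (suc m) f≡g =
  cong₂ _∷_ (f≡g fzero z<s) (prefix-cong m λ r r<m → f≡g (fsuc r) (s<s r<m))

∈-prefix⁻ : ∀ {n} (f : Fin n → ℕ) m {v} → v ∈ prefix f m → ∃ λ s → toℕ s < m × f s ≡ v
∈-prefix⁻ {suc n} f (suc m) (here refl)  = fzero , z<s , refl
∈-prefix⁻ {suc n} f (suc m) (there v∈)   with ∈-prefix⁻ (f ∘ fsuc) m v∈
... | s , s<m , fs≡v = fsuc s , s<s s<m , fs≡v

∈-prefix⁺ : ∀ {n} (f : Fin n → ℕ) {m} s → toℕ s < m → f s ∈ prefix f m
∈-prefix⁺ {suc n} f {suc m} fzero    _           = here refl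
∈-prefix⁺ {suc n} f {suc m} (fsuc s) (s<s s<m)   = there (∈-prefix⁺ (f ∘ fsuc) s s<m)

rowInduction : ∀ {n} (P : ℕ → Set) {a m} → a ≤ m → m ≤ n → P a →
               (∀ (r : Fin n) → a ≤ toℕ r → toℕ r < m → P (toℕ r) → P (suc (toℕ r))) → P m
rowInduction P {a} {zero} a≤0 _ Pa _ = subst P (n≤0⇒n≡0 a≤0) Pa
rowInduction P {a} {suc m} a≤1+m 1+m≤n Pa step with a ≤? m
... | no a≰m = subst P (≤-antisym a≤1+m (≰⇒> a≰m)) Pa
... | yes a≤m with fromℕ< 1+m≤n | toℕ-fromℕ< 1+m≤n
...   | r | refl = step r a≤m ≤-refl
  (rowInduction P a≤m (<⇒≤ 1+m≤n) Pa λ s a≤s s<r → step s a≤s (m<n⇒m<1+n s<r))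

module _ {n : ℕ} (t : ℕ) where

  private
    N : (Fin n → ℕ) → ℕ → ℕ
    N f m = count≥ t (prefix f m)

    ⟦_⟧ : ℕ → ℕ
    ⟦ v ⟧ = count≥ t [ v ]

  count≥-prefix-suc : ∀ (f : Fin n → ℕ) r → N f (suc (toℕ r)) ≡ N f (toℕ r) + ⟦ f r ⟧
  count≥-prefix-suc f r =
    trans (cong (count≥ t) (prefix-suc f r)) (count≥-++ t (prefix f (toℕ r)) [ f r ])

  count≥-prefix-offset : ∀ (f g : Fin n → ℕ) {a m d e} → a ≤ m → m ≤ n →
                         (∀ r → a ≤ toℕ r → toℕ r < m → ⟦ f r ⟧ ≡ ⟦ g r ⟧) →
                         N f a + d ≡ N g a + e → N f m + d ≡ N g m + e
  count≥-prefix-offset f g {a} {m} {d} {e} a≤m m≤n same base =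
    rowInduction (λ k → N f k + d ≡ N g k + e) a≤m m≤n base step
    where
    step : ∀ r → a ≤ toℕ r → toℕ r < m → N f (toℕ r) + d ≡ N g (toℕ r) + e →
           N f (suc (toℕ r)) + d ≡ N g (suc (toℕ r)) + e
    step r a≤r r<m ih = begin-equality
      N f (suc (toℕ r)) + d     ≡⟨ cong (_+ d) (count≥-prefix-suc f r) ⟩
      N f (toℕ r) + ⟦ f r ⟧ + d ≡⟨ xy∙z≈xz∙y (N f (toℕ r)) ⟦ f r ⟧ d ⟩
      N f (toℕ r) + d + ⟦ f r ⟧ ≡⟨ cong₂ _+_ ih (same r a≤r r<m) ⟩
      N g (toℕ r) + e + ⟦ g r ⟧ ≡⟨ xy∙z≈xz∙y (N g (toℕ r)) ⟦ g r ⟧ e ⟨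
      N g (toℕ r) + ⟦ g r ⟧ + e ≡⟨ cong (_+ e) (count≥-prefix-suc g r) ⟨
      N g (suc (toℕ r)) + e     ∎

  count≥-prefix-rowwise : ∀ (f g : Fin n → ℕ) {m} → m ≤ n → (∀ r → ⟦ f r ⟧ ≡ ⟦ g r ⟧) →
                          N f m ≡ N g m
  count≥-prefix-rowwise f g m≤n same = +-cancelʳ-≡ 0 _ _
    (count≥-prefix-offset f g {d = 0} {0} z≤n m≤n (λ r _ _ → same r) refl)

  count≥-prefix-saturated : ∀ (f g : Fin n → ℕ) {a m} → a ≤ m → m ≤ n →
                            (∀ r → a ≤ toℕ r → toℕ r < m → t ≤ g r) →
                            N f a ≤ N g a → N f m ≤ N g m
  count≥-prefix-saturated f g {a} {m} a≤m m≤n saturated base =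
    rowInduction (λ k → N f k ≤ N g k) a≤m m≤n base step
    where
    step : ∀ r → a ≤ toℕ r → toℕ r < m → N f (toℕ r) ≤ N g (toℕ r) →
           N f (suc (toℕ r)) ≤ N g (suc (toℕ r))
    step r a≤r r<m ih = begin
      N f (suc (toℕ r))     ≡⟨ count≥-prefix-suc f r ⟩
      N f (toℕ r) + ⟦ f r ⟧ ≤⟨ +-mono-≤ ih (count≥≤length t [ f r ]) ⟩
      N g (toℕ r) + 1       ≡⟨ cong (N g (toℕ r) +_) (count≥-all (saturated r a≤r r<m ∷ [])) ⟨
      N g (toℕ r) + ⟦ g r ⟧ ≡⟨ count≥-prefix-suc g r ⟨
      N g (suc (toℕ r))     ∎

  count≥-prefix-swap : ∀ (f g : Fin n → ℕ) (i k : Fin n) → toℕ i < toℕ k →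
                       g i ≡ f k → g k ≡ f i → (∀ r → r ≢ i → r ≢ k → g r ≡ f r) →
                       ∀ {m} → toℕ k < m → m ≤ n → N g m ≡ N f m
  count≥-prefix-swap f g i k i<k gi≡fk gk≡fi others k<m m≤n = +-cancelʳ-≡ 0 _ _
    (count≥-prefix-offset g f {d = 0} {0} k<m m≤n
      (λ r k<r _ → cong ⟦_⟧ (others r (<⇒≢ᶠ (<-trans i<k k<r) ∘ sym) (<⇒≢ᶠ k<r ∘ sym)))
      (cong (_+ 0) after-k))
    where
    at-i : N g (suc (toℕ i)) + ⟦ f i ⟧ ≡ N f (suc (toℕ i)) + ⟦ g i ⟧
    at-i = begin-equality
      N g (suc (toℕ i)) + ⟦ f i ⟧     ≡⟨ cong (_+ ⟦ f i ⟧) (count≥-prefix-suc g i) ⟩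
      N g (toℕ i) + ⟦ g i ⟧ + ⟦ f i ⟧ ≡⟨ cong (λ xs → count≥ t xs + ⟦ g i ⟧ + ⟦ f i ⟧) below ⟩
      N f (toℕ i) + ⟦ g i ⟧ + ⟦ f i ⟧ ≡⟨ xy∙z≈xz∙y (N f (toℕ i)) ⟦ g i ⟧ ⟦ f i ⟧ ⟩
      N f (toℕ i) + ⟦ f i ⟧ + ⟦ g i ⟧ ≡⟨ cong (_+ ⟦ g i ⟧) (count≥-prefix-suc f i) ⟨
      N f (suc (toℕ i)) + ⟦ g i ⟧     ∎
      where
      below : prefix g (toℕ i) ≡ prefix f (toℕ i)
      below = prefix-cong (toℕ i) λ r r<i → others r (<⇒≢ᶠ r<i) (<⇒≢ᶠ (<-trans r<i i<k))
    at-k : N g (toℕ k) + ⟦ f i ⟧ ≡ N f (toℕ k) + ⟦ g i ⟧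
    at-k = count≥-prefix-offset g f i<k (<⇒≤ (toℕ<n k))
      (λ r i<r r<k → cong ⟦_⟧ (others r (<⇒≢ᶠ i<r ∘ sym) (<⇒≢ᶠ r<k)))
      at-i
    after-k : N g (suc (toℕ k)) ≡ N f (suc (toℕ k))
    after-k = begin-equality
      N g (suc (toℕ k))     ≡⟨ count≥-prefix-suc g k ⟩
      N g (toℕ k) + ⟦ g k ⟧ ≡⟨ cong (λ v → N g (toℕ k) + ⟦ v ⟧) gk≡fi ⟩
      N g (toℕ k) + ⟦ f i ⟧ ≡⟨ at-k ⟩
      N f (toℕ k) + ⟦ g i ⟧ ≡⟨ cong (λ v → N f (toℕ k) + ⟦ v ⟧) gi≡fk ⟩
      N f (toℕ k) + ⟦ f k ⟧ ≡⟨ count≥-prefix-suc f k ⟨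
      N f (suc (toℕ k))     ∎

-- The greedy maximum 1̂

maxAvail-≤ : ∀ b used → maxAvail b used ≤ b
maxAvail-≤ zero    used = z≤n
maxAvail-≤ (suc b) used with suc b ∈? used
... | yes _ = m≤n⇒m≤1+n (maxAvail-≤ b used)
... | no _  = ≤-refl

maxAvail-above : ∀ b used {v} → maxAvail b used < v → v ≤ b → v ∈ used
maxAvail-above zero    used max<v v≤0 = contradiction v≤0 (<⇒≱ max<v)
maxAvail-above (suc b) used {v} max<v v≤1+b with suc b ∈? used
... | no _  = contradiction v≤1+b (<⇒≱ max<v)
... | yes 1+b∈used with v ≟ suc b
...   | yes refl = 1+b∈used
...   | no v≢1+b = maxAvail-above b used max<v (≤-pred (≤∧≢⇒< v≤1+b v≢1+b))

maxAvail-∈⇒0 : ∀ b used → maxAvail b used ∈ used → maxAvail b used ≡ 0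
maxAvail-∈⇒0 zero    used _ = refl
maxAvail-∈⇒0 (suc b) used with suc b ∈? used
... | yes _       = maxAvail-∈⇒0 b used
... | no 1+b∉used = λ 1+b∈used → contradiction 1+b∈used 1+b∉used

greedy-step : ∀ {n} used (lam : Fin n → ℕ) r →
              let h = lookup (hatGo used (Vec.tabulate lam)) in
              h r ≡ maxAvail (lam r) (used ++ prefix h (toℕ r))
greedy-step used lam fzero    = cong (maxAvail (lam fzero)) (sym (++-identityʳ used))
greedy-step used lam (fsuc r) =
  trans (greedy-step (used ++ [ maxAvail (lam fzero) used ]) (lam ∘ fsuc) r)
        (cong (maxAvail (lam (fsuc r))) (++-assoc used _ _))

oneHat-greedy : ∀ {n} (lam : Fin n → ℕ) r →
                oneHat lam r ≡ maxAvail (lam r) (prefix (oneHat lam) (toℕ r))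
oneHat-greedy = greedy-step []

module _ {n : ℕ} (lam : Fin n → ℕ) where

  private
    h : Fin n → ℕ
    h = oneHat lam

  oneHat≤lam : ∀ r → h r ≤ lam r
  oneHat≤lam r = subst (_≤ lam r) (sym (oneHat-greedy lam r)) (maxAvail-≤ (lam r) _)

  oneHat-columns-taken : ∀ r {v} → h r < v → v ≤ lam r → v ∈ prefix h (toℕ r)
  oneHat-columns-taken r hr<v v≤lam =
    maxAvail-above (lam r) _ (subst (_< _) (oneHat-greedy lam r) hr<v) v≤lam

  oneHat-repeat⇒0 : ∀ {p q} → toℕ p < toℕ q → h p ≡ h q → h q ≡ 0
  oneHat-repeat⇒0 {p} {q} p<q hp≡hq = trans (oneHat-greedy lam q) (maxAvail-∈⇒0 (lam q) _
    (subst (_∈ prefix h (toℕ q)) (trans hp≡hq (oneHat-greedy lam q)) (∈-prefix⁺ h p p<q)))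

  oneHat-injective : ∀ {r s} → 0 < h r → h s ≡ h r → s ≡ r
  oneHat-injective {r} {s} 0<hr hs≡hr with <-cmp (toℕ s) (toℕ r)
  ... | tri< s<r _ _ = contradiction (oneHat-repeat⇒0 s<r hs≡hr) (>⇒≢ 0<hr)
  ... | tri≈ _ s≡r _ = toℕ-injective s≡r
  ... | tri> _ _ r<s =
    contradiction (oneHat-repeat⇒0 r<s (sym hs≡hr)) (>⇒≢ (subst (0 <_) (sym hs≡hr) 0<hr))

  oneHat-later-≤ : ∀ {r k} → toℕ r < toℕ k → h k ≤ lam r → h k ≤ h r
  oneHat-later-≤ {r} {k} r<k hk≤lam with h k ≤? h r
  ... | yes hk≤hr = hk≤hr
  ... | no hk≰hr with ∈-prefix⁻ h (toℕ r) (oneHat-columns-taken r (≰⇒> hk≰hr) hk≤lam)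
  ...   | s , s<r , hs≡hk =
    contradiction (oneHat-injective (≤-<-trans z≤n (≰⇒> hk≰hr)) hs≡hk) (<⇒≢ᶠ (<-trans s<r r<k))

  count≥-prefix-≤-oneHat : IsPartition lam → ∀ {x} → IsPlacement lam x →
                           ∀ t {m} → m ≤ n → count≥ t (prefix x m) ≤ count≥ t (prefix h m)
  count≥-prefix-≤-oneHat lam-mono {x} (x-inj , x-bounds) t {m} m≤n =
    rowInduction (λ k → N x k ≤ N h k) z≤n m≤n z≤n step
    where
    N : (Fin n → ℕ) → ℕ → ℕ
    N f k = count≥ t (prefix f k)
    step : ∀ r → 0 ≤ toℕ r → toℕ r < m → N x (toℕ r) ≤ N h (toℕ r) →
           N x (suc (toℕ r)) ≤ N h (suc (toℕ r))
    step r _ _ ih with t ≤? h r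
    ... | yes t≤hr = begin
      N x (suc (toℕ r))              ≡⟨ count≥-prefix-suc t x r ⟩
      N x (toℕ r) + count≥ t [ x r ] ≤⟨ +-mono-≤ ih (count≥≤length t [ x r ]) ⟩
      N h (toℕ r) + 1                ≡⟨ cong (N h (toℕ r) +_) (count≥-all (t≤hr ∷ [])) ⟨
      N h (toℕ r) + count≥ t [ h r ] ≡⟨ count≥-prefix-suc t h r ⟨
      N h (suc (toℕ r))              ∎
    ... | no t≰hr = begin
      N x (suc (toℕ r))              ≤⟨ count≥-unique-≤-cover (prefix-unique x-inj (suc (toℕ r)))
                                          (All.tabulate ≤lam)
                                          (λ t≤v → oneHat-columns-taken r (<-≤-trans (≰⇒> t≰hr) t≤v)) ⟩
      N h (toℕ r)                    ≡⟨ +-identityʳ (N h (toℕ r)) ⟨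
      N h (toℕ r) + 0                ≡⟨ cong (N h (toℕ r) +_) (count≥-none (≰⇒> t≰hr ∷ [])) ⟨
      N h (toℕ r) + count≥ t [ h r ] ≡⟨ count≥-prefix-suc t h r ⟨
      N h (suc (toℕ r))              ∎
      where
      ≤lam : ∀ {v} → v ∈ prefix x (suc (toℕ r)) → v ≤ lam r
      ≤lam v∈ with ∈-prefix⁻ x (suc (toℕ r)) v∈
      ... | s , s<1+r , refl = ≤-trans (proj₂ (x-bounds s)) (lam-mono s r (≤-pred s<1+r))

  -- end is the row that receives column 1̂_i in a switch move, and n for a push move.
  record Lowering (c : Fin n → ℕ) (i : Fin n) : Set where
    field
      end           : ℕ
      end≤n         : end ≤ n
      below         : ∀ r → toℕ r < toℕ i → c r ≡ h r
      between       : ∀ r → toℕ i < toℕ r → toℕ r < end → h i ≤ c r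
      outside-range : ∀ t r → t ≤ c i ⊎ h i < t → count≥ t [ c r ] ≡ count≥ t [ h r ]
      beyond        : ∀ t {m} → end < m → m ≤ n → count≥ t (prefix c m) ≡ count≥ t (prefix h m)

  Lowering⇒≤P⇔ : IsPartition lam → ∀ {c i x} → Lowering c i → IsPlacement lam x →
                 (x ≤P c) ⇔ SortedLeq (prefix x (suc (toℕ i))) (prefix h (toℕ i) ++ [ c i ])
  Lowering⇒≤P⇔ lam-mono {c} {i} {x} L x-placement = mk⇔ to from
    where
    open Lowering L

    SortedLeq⇔count≥-prefix : ∀ f g m → SortedLeq (prefix f m) (prefix g m) ⇔
                              (∀ t → count≥ t (prefix f m) ≤ count≥ t (prefix g m))
    SortedLeq⇔count≥-prefix f g m =
      SortedLeq⇔count≥ (trans (length-prefix f m) (sym (length-prefix g m)))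

    prefix-c : prefix c (suc (toℕ i)) ≡ prefix h (toℕ i) ++ [ c i ]
    prefix-c = trans (prefix-suc c i) (cong (_++ [ c i ]) (prefix-cong (toℕ i) below))

    to : x ≤P c → SortedLeq (prefix x (suc (toℕ i))) (prefix h (toℕ i) ++ [ c i ])
    to x≤c = subst (SortedLeq (prefix x (suc (toℕ i)))) prefix-c
                   (x≤c (suc (toℕ i)) (s≤s z≤n) (toℕ<n i))

    via-oneHat : ∀ t {m} → m ≤ n → count≥ t (prefix c m) ≡ count≥ t (prefix h m) →
                 count≥ t (prefix x m) ≤ count≥ t (prefix c m)
    via-oneHat t {m} m≤n c≡h = subst (count≥ t (prefix x m) ≤_) (sym c≡h)
                                     (count≥-prefix-≤-oneHat lam-mono x-placement t m≤n)

    from : SortedLeq (prefix x (suc (toℕ i))) (prefix h (toℕ i) ++ [ c i ]) → x ≤P c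
    from hyp m _ m≤n = Equivalence.from (SortedLeq⇔count≥-prefix x c m) (λ t → dominated t m≤n)
      where
      at-i : ∀ t → count≥ t (prefix x (suc (toℕ i))) ≤ count≥ t (prefix c (suc (toℕ i)))
      at-i = Equivalence.to (SortedLeq⇔count≥-prefix x c (suc (toℕ i)))
               (subst (SortedLeq (prefix x (suc (toℕ i)))) (sym prefix-c) hyp)

      dominated : ∀ t {m} → m ≤ n → count≥ t (prefix x m) ≤ count≥ t (prefix c m)
      dominated t {m} m≤n with m ≤? toℕ i | end <? m | t ≤? c i | h i <? t
      ... | yes m≤i | _         | _        | _ = via-oneHat t m≤n
        (cong (count≥ t) (prefix-cong m λ r r<m → below r (<-≤-trans r<m m≤i)))
      ... | no _    | yes end<m | _        | _ = via-oneHat t m≤n (beyond t end<m m≤n)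
      ... | no _    | no _      | yes t≤ci | _ = via-oneHat t m≤n
        (count≥-prefix-rowwise t c h m≤n λ r → outside-range t r (inj₁ t≤ci))
      ... | no _    | no _      | no _     | yes hi<t = via-oneHat t m≤n
        (count≥-prefix-rowwise t c h m≤n λ r → outside-range t r (inj₂ hi<t))
      ... | no m≰i  | no end≮m  | no _     | no hi≮t =
        count≥-prefix-saturated t x c (≰⇒> m≰i) m≤n
          (λ r i<r r<m → ≤-trans (≮⇒≥ hi≮t) (between r i<r (<-≤-trans r<m (≮⇒≥ end≮m))))
          (at-i t)

  switch⇒Lowering : IsPartition lam → ∀ {c i} → SwitchMove h c i → Lowering c i
  switch⇒Lowering lam-mono {c} {i} (k , i<k , hk<hi , empty , ci≡hk , ck≡hi , others) = record
    { end           = toℕ k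
    ; end≤n         = <⇒≤ (toℕ<n k)
    ; below         = λ r r<i → others r (<⇒≢ᶠ r<i) (<⇒≢ᶠ (<-trans r<i i<k))
    ; between       = between
    ; outside-range = outside-range
    ; beyond        = λ t → count≥-prefix-swap t h c i k i<k ci≡hk ck≡hi others
    }
    where
    between : ∀ r → toℕ i < toℕ r → toℕ r < toℕ k → h i ≤ c r
    between r i<r r<k = subst (h i ≤_) (sym (others r r≢i r≢k)) (<⇒≤ (≰⇒> λ hr≤hi →
      empty r r≢i r≢k (<⇒≤ i<r , <⇒≤ r<k , hk≤hr , hr≤hi)))
      where
      r≢i : r ≢ i
      r≢i = <⇒≢ᶠ i<r ∘ sym
      r≢k : r ≢ k
      r≢k = <⇒≢ᶠ r<k
      hk≤hr : h k ≤ h r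
      hk≤hr = oneHat-later-≤ r<k
        (≤-trans (<⇒≤ hk<hi) (≤-trans (oneHat≤lam i) (lam-mono i r (<⇒≤ i<r))))

    outside-range : ∀ t r → t ≤ c i ⊎ h i < t → count≥ t [ c r ] ≡ count≥ t [ h r ]
    outside-range t r range with r Fin.≟ i | r Fin.≟ k
    ... | yes refl | _        = trans (cong (count≥ t ∘ [_]) ci≡hk)
                                       (count≥-[-]-cong (<⇒≤ hk<hi) (map₁ (subst (t ≤_) ci≡hk) range))
    ... | no _     | yes refl = trans (cong (count≥ t ∘ [_]) ck≡hi)
                                       (sym (count≥-[-]-cong (<⇒≤ hk<hi) (map₁ (subst (t ≤_) ci≡hk) range)))
    ... | no r≢i   | no r≢k   = cong (count≥ t ∘ [_]) (others r r≢i r≢k)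

  push⇒Lowering : IsPartition lam → ∀ {c i} → PushMove h c i → Lowering c i
  push⇒Lowering lam-mono {c} {i} (k , _ , k<hi , k-empty , k-gap , ci≡k , others) = record
    { end           = n
    ; end≤n         = ≤-refl
    ; below         = λ r r<i → others r (<⇒≢ᶠ r<i)
    ; between       = λ r i<r _ → subst (h i ≤_) (sym (others r (<⇒≢ᶠ i<r ∘ sym))) (<⇒≤ (later-right r i<r))
    ; outside-range = outside-range
    ; beyond        = λ _ n<m m≤n → contradiction m≤n (<⇒≱ n<m)
    }
    where
    later-right : ∀ r → toℕ i < toℕ r → h i < h r
    later-right r i<r with <-cmp (h r) k
    ... | tri< hr<k _ _ with ∈-prefix⁻ h (toℕ r) (oneHat-columns-taken r hr<k
                               (≤-trans (<⇒≤ k<hi) (≤-trans (oneHat≤lam i) (lam-mono i r (<⇒≤ i<r)))))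
    ...   | s , _ , hs≡k = contradiction hs≡k (k-empty s)
    later-right r i<r | tri≈ _ hr≡k _ = contradiction hr≡k (k-empty r)
    later-right r i<r | tri> _ _ k<hr with <-cmp (h i) (h r)
    ... | tri< hi<hr _ _ = hi<hr
    ... | tri≈ _ hi≡hr _ = contradiction (oneHat-injective (≤-<-trans z≤n k<hr) hi≡hr) (<⇒≢ᶠ i<r)
    ... | tri> _ _ hr<hi with k-gap (h r) k<hr hr<hi
    ...   | s , s<i , hs≡hr =
      contradiction (oneHat-injective (≤-<-trans z≤n k<hr) hs≡hr) (<⇒≢ᶠ (<-trans s<i i<r))

    outside-range : ∀ t r → t ≤ c i ⊎ h i < t → count≥ t [ c r ] ≡ count≥ t [ h r ]
    outside-range t r range with r Fin.≟ i
    ... | yes refl = trans (cong (count≥ t ∘ [_]) ci≡k)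
                           (count≥-[-]-cong (<⇒≤ k<hi) (map₁ (subst (t ≤_) ci≡k) range))
    ... | no r≢i   = cong (count≥ t ∘ [_]) (others r r≢i)

-- λ_r ≥ r only makes 1̂ a genuine placement and g_i ≠ 0 only makes the coatom exist; the move
-- hypothesis already supplies c.
mainTheorem8 : (n : ℕ) (lam : Fin n → ℕ) → IsPartition lam
    → (∀ (i : Fin n) → suc (toℕ i) ≤ lam i)
    → (i : Fin n) → lam i ≢ suc (toℕ i)
    → (c : Fin n → ℕ) → SwitchMove (oneHat lam) c i ⊎ PushMove (oneHat lam) c i
    → (x : Fin n → ℕ) → IsPlacement lam x
    → (x ≤P c) ⇔ SortedLeq (prefix x (suc (toℕ i))) (prefix (oneHat lam) (toℕ i) ++ (c i ∷ []))
mainTheorem8 n lam lam-mono _ i _ c move x x-placement =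
  Lowering⇒≤P⇔ lam lam-mono
    ([ switch⇒Lowering lam lam-mono , push⇒Lowering lam lam-mono ]′ move)
    x-placement
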